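{- Let $G$ be a graph. If $G$ has a pan cycle $C$, then $\mathsf{pn}(G)=\mathsf{pn}(G-C)+1$, where $G-C$ denotes the graph obtained from $G$ by deleting all edges of $C$.
   Context: All graphs are finite, simple and undirected. A path partition of $G$ is a collection of pairwise edge-disjoint paths in $G$ whose edge sets together cover $E(G)$; $\mathsf{pn}(G)$ is the minimum size of a path partition of $G$. A cycle $C$ in $G$ is a pan cycle if there is a unique vertex $v\in V(C)$ with $\deg_G(v)=3$ and $\deg_G(w)=2$ for all other $w\in V(C)$. -}

module Defs where

open import Data.Nat using (ℕ; zero; suc; _≤_; _+_)
open import Data.Fin using (Fin)
import Data.Fin as Fin
open import Data.Bool using (Bool; true; false; _∧_; _∨_; not; if_then_else_)
open import Data.Bool.Properties using (∨-comm; ∨-assoc; ∧-zeroʳ)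
open import Data.List using (List; []; _∷_; _++_; length; take; map; allFin; lookup)
open import Data.Nat.ListAction using (sum)
open import Data.List.Relation.Unary.All using (All)
open import Data.List.Relation.Unary.Unique.Propositional using (Unique)
open import Data.List.Membership.Propositional using (_∈_)
open import Data.Product using (Σ; ∃; _×_; _,_)
open import Data.Unit using (⊤)
open import Relation.Nullary using (¬_)
open import Relation.Nullary.Decidable using (⌊_⌋)
open import Relation.Binary.PropositionalEquality using (_≡_; refl; cong; cong₂; sym; trans)

_==_ : {n : ℕ} → Fin n → Fin n → Bool
x == y = ⌊ x Fin.≟ y ⌋

record Graph (n : ℕ) : Set where
  field
    adj    : Fin n → Fin n → Bool
    adj-sym : ∀ u v → adj u v ≡ adj v u
    adj-irr : ∀ v → adj v v ≡ false
open Graph public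

walkHas : {n : ℕ} → List (Fin n) → Fin n → Fin n → Bool
walkHas [] u v = false
walkHas (x ∷ []) u v = false
walkHas (x ∷ y ∷ r) u v = ((x == u) ∧ (y == v)) ∨ (((x == v) ∧ (y == u)) ∨ walkHas (y ∷ r) u v)

private
  swap∨ : ∀ a b c → a ∨ (b ∨ c) ≡ b ∨ (a ∨ c)
  swap∨ a b c = trans (sym (∨-assoc a b c)) (trans (cong (_∨ c) (∨-comm a b)) (∨-assoc b a c))

walkHas-sym : {n : ℕ} (W : List (Fin n)) (u v : Fin n) → walkHas W u v ≡ walkHas W v u
walkHas-sym [] u v = refl
walkHas-sym (x ∷ []) u v = refl
walkHas-sym (x ∷ y ∷ r) u v =
  trans (cong (λ t → ((x == u) ∧ (y == v)) ∨ (((x == v) ∧ (y == u)) ∨ t)) (walkHas-sym (y ∷ r) u v))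
        (swap∨ ((x == u) ∧ (y == v)) ((x == v) ∧ (y == u)) (walkHas (y ∷ r) v u))

WalkIn : {n : ℕ} → Graph n → List (Fin n) → Set
WalkIn G [] = ⊤
WalkIn G (x ∷ []) = ⊤
WalkIn G (x ∷ y ∷ r) = (adj G x y ≡ true) × WalkIn G (y ∷ r)

IsPath : {n : ℕ} → Graph n → List (Fin n) → Set
IsPath G P = Unique P × WalkIn G P

deg : {n : ℕ} → Graph n → Fin n → ℕ
deg {n} G v = sum (map (λ u → if adj G v u then 1 else 0) (allFin n))

-- a cycle: distinct vertices c₀ … c_{k-1}, k ≥ 3, with c_i c_{i+1} and c_{k-1} c₀ edges
record Cycle {n : ℕ} (G : Graph n) : Set where
  field
    verts   : List (Fin n)
    len≥3   : 3 ≤ length verts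
    distinct : Unique verts
    closed  : WalkIn G (verts ++ take 1 verts)
open Cycle public

cycleHas : {n : ℕ} {G : Graph n} → Cycle G → Fin n → Fin n → Bool
cycleHas C u v = walkHas (verts C ++ take 1 (verts C)) u v

IsPanCycle : {n : ℕ} (G : Graph n) → Cycle G → Set
IsPanCycle G C = Σ (Fin _) λ v → (v ∈ verts C) × (deg G v ≡ 3) ×
                   (∀ w → w ∈ verts C → ¬ (w ≡ v) → deg G w ≡ 2)

_−C_ : {n : ℕ} (G : Graph n) → Cycle G → Graph n
G −C C = record
  { adj = λ u v → adj G u v ∧ not (cycleHas C u v)
  ; adj-sym = λ u v → cong₂ _∧_ (adj-sym G u v) (cong not (walkHas-sym (verts C ++ take 1 (verts C)) u v))
  ; adj-irr = λ v → trans (cong (_∧ not (cycleHas C v v)) (adj-irr G v)) refl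
  }

record PathPartition {n : ℕ} (G : Graph n) : Set where
  field
    paths    : List (List (Fin n))
    arePaths : All (IsPath G) paths
    disjoint : ∀ (i j : Fin (length paths)) → ¬ (i ≡ j) → ∀ u v →
               walkHas (lookup paths i) u v ≡ true → walkHas (lookup paths j) u v ≡ false
    covers   : ∀ u v → adj G u v ≡ true → ∃ λ (i : Fin (length paths)) → walkHas (lookup paths i) u v ≡ true
open PathPartition public

size : {n : ℕ} {G : Graph n} → PathPartition G → ℕ
size P = length (paths P)

IsPn : {n : ℕ} → Graph n → ℕ → Set
IsPn G k = (Σ (PathPartition G) λ P → size P ≡ k) × (∀ (P : PathPartition G) → k ≤ size P)

-- Let v be the vertex of degree 3 on the pan cycle C, u its neighbour off C (the handle v u) and a, b
-- its neighbours on C. The other vertices of C have degree 2, so all their edges lie on C; hence a path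
-- of G can pass between edges of C and edges of G - C only at v, and as it visits v at most once, its
-- edges in G - C form a single run of consecutive edges.
-- pn(G - C) < pn(G): cut every path of a partition of G down to that run. Of the paths through v a and
-- v b, one avoids v u, hence has no edge in G - C at all, and disappears.
-- pn(G) ≤ pn(G - C) + 1: in a partition of G - C the vertex v has degree 1, so the path through v u
-- ends at v; continue it around C from v to b, and add the remaining edge b v as a new path.
module Submission where

open import Defs
open import Data.Bool using (Bool; true; false; not; _∧_; if_then_else_)
open import Data.Bool.Properties using (T-≡; ∧-conicalˡ; ∧-conicalʳ; not-injective)
import Data.Bool.Properties as Bool
open import Data.Empty using (⊥; ⊥-elim)
open import Data.Fin using (Fin)
import Data.Fin as Fin
import Data.Fin.Properties as Finₚ
open import Data.List using (List; []; _∷_; _++_; [_]; length; lookup; filter; allFin; map; reverse; take; initLast; _∷ʳ′_)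
open import Data.List.Properties
  using (length-map; filter-notAll; length-++-sucʳ; length-++-comm; ++-assoc; ++-identityʳ;
         unfold-reverse; reverse-involutive; reverse-++)
open import Data.List.Membership.Propositional using (_∈_; _∉_; find; lose)
open import Data.List.Membership.Propositional.Properties
  using (∈-map⁺; ∈-∃++; ∈-++⁺ˡ; ∈-++⁺ʳ; ∈-++⁻; ∈-lookup; ∈-filter⁺; ∈-filter⁻; ∈-allFin)
open import Data.List.Relation.Binary.Disjoint.Propositional using (Disjoint)
import Data.List.Relation.Binary.Permutation.Setoid as ↭
import Data.List.Relation.Binary.Permutation.Setoid.Properties as ↭ₚ
open import Data.List.Relation.Binary.Subset.Propositional using (_⊆_)
open import Data.List.Relation.Unary.All as All using (All; []; _∷_)
import Data.List.Relation.Unary.All.Properties as Allₚ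
open import Data.List.Relation.Unary.AllPairs as AllPairs using (AllPairs; []; _∷_)
import Data.List.Relation.Unary.AllPairs.Properties as AllPairsₚ
open import Data.List.Relation.Unary.Any as Any using (Any; here; there)
open import Data.List.Relation.Unary.Any.Properties using (lookup-index)
open import Data.List.Relation.Unary.Unique.Propositional using (Unique)
import Data.List.Relation.Unary.Unique.Propositional.Properties as Unique
open import Data.Nat using (ℕ; suc; _≤_; _≤?_; z≤n; s≤s)
open import Data.Nat.ListAction using (sum)
open import Data.Nat.Properties using (n≮n; ≤-trans; ≤-antisym)
open import Data.Product using (Σ; ∃; ∃₂; _×_; _,_; proj₁; proj₂)
open import Data.Sum using (_⊎_; inj₁; inj₂; [_,_]′; map₁)
open import Data.Unit using (tt)
open import Function using (_∘_; id)
open import Function.Bundles using (Equivalence; _⇔_; mk⇔)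
open import Relation.Nullary using (¬_; ¬?; Dec; yes; no; _because_; _×-dec_; contradiction)
open import Relation.Nullary.Decidable using (T?; dec-true; dec-false)
open import Relation.Nullary.Reflects using (Reflects; ofʸ; ofⁿ; invert; _×-reflects_; _⊎-reflects_)
import Relation.Binary.PropositionalEquality as ≡
open import Relation.Binary.PropositionalEquality
  using (_≡_; _≢_; refl; sym; trans; cong; cong₂; subst; subst₂; module ≡-Reasoning)

module _ {A : Set} where

  Unique⇒length≤ : {xs ys : List A} → Unique xs → xs ⊆ ys → length xs ≤ length ys
  Unique⇒length≤ {[]} _ _ = z≤n
  Unique⇒length≤ {x ∷ xs} (x∉xs ∷ u) xs⊆ys with ∈-∃++ (xs⊆ys (here refl))
  ... | B , C , refl = subst (suc (length xs) ≤_) (sym (length-++-sucʳ B x C)) (s≤s (Unique⇒length≤ u xs⊆B++C))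
    where
    xs⊆B++C : xs ⊆ B ++ C
    xs⊆B++C {z} z∈xs with ∈-++⁻ B (xs⊆ys (there z∈xs))
    ... | inj₁ z∈B = ∈-++⁺ˡ z∈B
    ... | inj₂ (here refl) = ⊥-elim (All.lookup x∉xs z∈xs refl)
    ... | inj₂ (there z∈C) = ∈-++⁺ʳ B z∈C

  Unique-++⁻ : (xs : List A) {ys : List A} → Unique (xs ++ ys) → Unique xs × Unique ys × Disjoint xs ys
  Unique-++⁻ [] u = [] , u , λ ()
  Unique-++⁻ (x ∷ xs) (x∉ ∷ u) with Unique-++⁻ xs u
  ... | uxs , uys , xs∩ys=∅ = Allₚ.++⁻ˡ xs x∉ ∷ uxs , uys , λ where
    (here refl , z∈ys) → All.lookup (Allₚ.++⁻ʳ xs x∉) z∈ys refl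
    (there z∈xs , z∈ys) → xs∩ys=∅ (z∈xs , z∈ys)

  Unique-++-comm : (xs : List A) {ys : List A} → Unique (xs ++ ys) → Unique (ys ++ xs)
  Unique-++-comm xs u with Unique-++⁻ xs u
  ... | uxs , uys , xs∩ys=∅ = Unique.++⁺ uys uxs (λ (z∈ys , z∈xs) → xs∩ys=∅ (z∈xs , z∈ys))

  Unique-split : (xs : List A) {x : A} {ys : List A} → Unique (xs ++ x ∷ ys) → Unique (xs ++ [ x ]) × Unique (x ∷ ys)
  Unique-split xs u with Unique-++⁻ xs u
  ... | uxs , uxys , xs∩xys=∅ =
    Unique.++⁺ uxs ([] ∷ []) (λ where (z∈xs , here refl) → xs∩xys=∅ (z∈xs , here refl)) , uxys

  Unique-reverse : {xs : List A} → Unique xs → Unique (reverse xs)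
  Unique-reverse {xs} = ↭ₚ.Unique-resp-↭ ≡-setoid (↭.↭-sym ≡-setoid (↭ₚ.↭-reverse ≡-setoid xs))
    where ≡-setoid = ≡.setoid A

  AllPairs-fromLookup : {R : A → A → Set} (xs : List A) →
                        (∀ i j → i ≢ j → R (lookup xs i) (lookup xs j)) → AllPairs R xs
  AllPairs-fromLookup [] _ = []
  AllPairs-fromLookup {R} (x ∷ xs) R-lookup =
    All.tabulate (λ y∈xs → subst (R x) (sym (lookup-index y∈xs)) (R-lookup Fin.zero (Fin.suc (Any.index y∈xs)) λ ())) ∷
    AllPairs-fromLookup xs (λ i j i≢j → R-lookup (Fin.suc i) (Fin.suc j) (i≢j ∘ Finₚ.suc-injective))

  AllPairs-lookup : {R : A → A → Set} → (∀ {x y} → R x y → R y x) → {xs : List A} → AllPairs R xs →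
                    ∀ i j → i ≢ j → R (lookup xs i) (lookup xs j)
  AllPairs-lookup R-sym (_ ∷ _) Fin.zero Fin.zero 0≢0 = ⊥-elim (0≢0 refl)
  AllPairs-lookup R-sym (Rx ∷ _) Fin.zero (Fin.suc j) _ = All.lookup Rx (∈-lookup j)
  AllPairs-lookup R-sym (Rx ∷ _) (Fin.suc i) Fin.zero _ = R-sym (All.lookup Rx (∈-lookup i))
  AllPairs-lookup R-sym (_ ∷ R-xs) (Fin.suc i) (Fin.suc j) i≢j = AllPairs-lookup R-sym R-xs i j (i≢j ∘ cong Fin.suc)

infix 4 _∋_—_

data _∋_—_ {A : Set} : List A → A → A → Set where
  first  : ∀ {x y r} → x ∷ y ∷ r ∋ x — y
  first˘ : ∀ {x y r} → x ∷ y ∷ r ∋ y — x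
  later  : ∀ {x y r a b} → y ∷ r ∋ a — b → x ∷ y ∷ r ∋ a — b

module _ {A : Set} where
  open ≡-Reasoning

  ∋—-sym : {W : List A} {a b : A} → W ∋ a — b → W ∋ b — a
  ∋—-sym first     = first˘
  ∋—-sym first˘    = first
  ∋—-sym (later e) = later (∋—-sym e)

  ∋—⇒∈ : {W : List A} {a b : A} → W ∋ a — b → a ∈ W
  ∋—⇒∈ first     = here refl
  ∋—⇒∈ first˘    = there (here refl)
  ∋—⇒∈ (later e) = there (∋—⇒∈ e)

  ∋—⇒2≤length : {W : List A} {a b : A} → W ∋ a — b → 2 ≤ length W
  ∋—⇒2≤length first     = s≤s (s≤s z≤n)
  ∋—⇒2≤length first˘    = s≤s (s≤s z≤n)
  ∋—⇒2≤length (later _) = s≤s (s≤s z≤n)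

  ∈⇒∋— : {W : List A} {a b x : A} → W ∋ a — b → x ∈ W → ∃ λ y → W ∋ x — y
  ∈⇒∋— {y ∷ z ∷ r} _ (here refl) = z , first
  ∈⇒∋— {y ∷ z ∷ r} _ (there (here refl)) = y , first˘
  ∈⇒∋— {y ∷ z ∷ s ∷ r} _ (there (there x∈r)) with ∈⇒∋— first (there x∈r)
  ... | w , e = w , later e

  ∋—-pair : {y z c d : A} → y ∷ z ∷ [] ∋ c — d → (c ≡ y × d ≡ z) ⊎ (c ≡ z × d ≡ y)
  ∋—-pair first  = inj₁ (refl , refl)
  ∋—-pair first˘ = inj₂ (refl , refl)

  ∋—-++⁻ : (L : List A) {y : A} {R : List A} {a b : A} →
           L ++ y ∷ R ∋ a — b → L ++ [ y ] ∋ a — b ⊎ y ∷ R ∋ a — b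
  ∋—-++⁻ [] e = inj₂ e
  ∋—-++⁻ (x ∷ []) first = inj₁ first
  ∋—-++⁻ (x ∷ []) first˘ = inj₁ first˘
  ∋—-++⁻ (x ∷ []) (later e) = inj₂ e
  ∋—-++⁻ (x ∷ x′ ∷ L) first = inj₁ first
  ∋—-++⁻ (x ∷ x′ ∷ L) first˘ = inj₁ first˘
  ∋—-++⁻ (x ∷ x′ ∷ L) (later e) = map₁ later (∋—-++⁻ (x′ ∷ L) e)

  ∋—-++⁺ˡ : (L : List A) {y : A} {R : List A} {a b : A} → L ++ [ y ] ∋ a — b → L ++ y ∷ R ∋ a — b
  ∋—-++⁺ˡ (x ∷ []) first = first
  ∋—-++⁺ˡ (x ∷ []) first˘ = first˘
  ∋—-++⁺ˡ (x ∷ x′ ∷ L) first = first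
  ∋—-++⁺ˡ (x ∷ x′ ∷ L) first˘ = first˘
  ∋—-++⁺ˡ (x ∷ x′ ∷ L) (later e) = later (∋—-++⁺ˡ (x′ ∷ L) e)

  ∋—-++⁺ʳ : (L : List A) {y : A} {R : List A} {a b : A} → y ∷ R ∋ a — b → L ++ y ∷ R ∋ a — b
  ∋—-++⁺ʳ [] e = e
  ∋—-++⁺ʳ (x ∷ []) e = later e
  ∋—-++⁺ʳ (x ∷ x′ ∷ L) e = later (∋—-++⁺ʳ (x′ ∷ L) e)

  ∋—-reverse⁺ : {W : List A} {a b : A} → W ∋ a — b → reverse W ∋ a — b
  ∋—-reverse⁺ {x ∷ y ∷ r} {a} {b} e = subst (_∋ a — b) (sym reverse-xyr) (reversed e)
    where
    reverse-xyr : reverse (x ∷ y ∷ r) ≡ reverse r ++ y ∷ [ x ]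
    reverse-xyr = begin
      reverse (x ∷ y ∷ r)           ≡⟨ unfold-reverse x (y ∷ r) ⟩
      reverse (y ∷ r) ++ [ x ]      ≡⟨ cong (_++ [ x ]) (unfold-reverse y r) ⟩
      (reverse r ++ [ y ]) ++ [ x ] ≡⟨ ++-assoc (reverse r) [ y ] [ x ] ⟩
      reverse r ++ y ∷ [ x ]        ∎
    reversed : x ∷ y ∷ r ∋ a — b → reverse r ++ y ∷ [ x ] ∋ a — b
    reversed first = ∋—-++⁺ʳ (reverse r) first˘
    reversed first˘ = ∋—-++⁺ʳ (reverse r) first
    reversed (later e) = ∋—-++⁺ˡ (reverse r) (subst (_∋ a — b) (unfold-reverse y r) (∋—-reverse⁺ e))

  ∋—-reverse⁻ : {W : List A} {a b : A} → reverse W ∋ a — b → W ∋ a — b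
  ∋—-reverse⁻ {W} {a} {b} e = subst (_∋ a — b) (reverse-involutive W) (∋—-reverse⁺ e)

  SameEdges : List A → List A → Set
  SameEdges W W′ = ∀ {a b} → W ∋ a — b ⇔ W′ ∋ a — b

  ∋—-rotate : (L M : List A) {y z a b : A} →
              y ∷ L ++ z ∷ M ++ [ y ] ∋ a — b → z ∷ M ++ y ∷ L ++ [ z ] ∋ a — b
  ∋—-rotate L M e = [ ∋—-++⁺ʳ (_ ∷ M) , ∋—-++⁺ˡ (_ ∷ M) ]′ (∋—-++⁻ (_ ∷ L) e)

  Unique-head-neighbour : {x y z : A} {r : List A} → Unique (x ∷ y ∷ r) → x ∷ y ∷ r ∋ x — z → z ≡ y
  Unique-head-neighbour _ first = refl
  Unique-head-neighbour ((x≢x ∷ _) ∷ _) first˘ = ⊥-elim (x≢x refl)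
  Unique-head-neighbour u (later e) = ⊥-elim (Unique.Unique[x∷xs]⇒x∉xs u (∋—⇒∈ e))

  Unique-head-neighbours : {x y z : A} {W : List A} → Unique (x ∷ W) → x ∷ W ∋ x — y → x ∷ W ∋ x — z → y ≡ z
  Unique-head-neighbours {W = _ ∷ _} u e e′ = trans (Unique-head-neighbour u e) (sym (Unique-head-neighbour u e′))

  Unique-last-neighbours : (L : List A) {x y z : A} → Unique (L ++ [ x ]) →
                           L ++ [ x ] ∋ x — y → L ++ [ x ] ∋ x — z → y ≡ z
  Unique-last-neighbours L {x} u e e′ =
    Unique-head-neighbours (subst Unique reversed (Unique-reverse u))
      (subst (_∋ x — _) reversed (∋—-reverse⁺ e)) (subst (_∋ x — _) reversed (∋—-reverse⁺ e′))
    where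
    reversed : reverse (L ++ [ x ]) ≡ x ∷ reverse L
    reversed = reverse-++ L [ x ]

  path-noThreeNeighbours : {W : List A} {v x y z : A} → Unique W →
                           W ∋ v — x → W ∋ v — y → W ∋ v — z → x ≢ y → x ≢ z → y ≢ z → ⊥
  path-noThreeNeighbours u ex ey ez x≢y x≢z y≢z with ∈-∃++ (∋—⇒∈ ex)
  ... | L , R , refl with Unique-split L u
  ... | uL , uR with ∋—-++⁻ L ex | ∋—-++⁻ L ey | ∋—-++⁻ L ez
  ... | inj₁ ex′ | inj₁ ey′ | _        = x≢y (Unique-last-neighbours L uL ex′ ey′)
  ... | inj₁ ex′ | inj₂ _   | inj₁ ez′ = x≢z (Unique-last-neighbours L uL ex′ ez′)
  ... | inj₁ _   | inj₂ ey′ | inj₂ ez′ = y≢z (Unique-head-neighbours uR ey′ ez′)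
  ... | inj₂ _   | inj₁ ey′ | inj₁ ez′ = y≢z (Unique-last-neighbours L uL ey′ ez′)
  ... | inj₂ ex′ | inj₁ _   | inj₂ ez′ = x≢z (Unique-head-neighbours uR ex′ ez′)
  ... | inj₂ ex′ | inj₂ ey′ | _        = x≢y (Unique-head-neighbours uR ex′ ey′)

  path-endpoint : {P : List A} {v : A} → Unique P → v ∈ P →
                  (∀ {x y} → P ∋ v — x → P ∋ v — y → x ≡ y) →
                  (∃ λ X → P ≡ X ++ [ v ]) ⊎ (∃ λ Y → P ≡ v ∷ Y)
  path-endpoint {v = v} uniq v∈P one-neighbour with ∈-∃++ v∈P
  ... | X , [] , refl = inj₁ (X , refl)
  ... | X , y ∷ Y , refl with initLast X
  ...   | [] = inj₂ (y ∷ Y , refl)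
  ...   | X′ ∷ʳ′ x = ⊥-elim (Unique.Unique[x∷xs]⇒x∉xs x∷v∷y∷Y-unique (there (here x≡y)))
    where
    P≡ : (X′ ++ [ x ]) ++ v ∷ y ∷ Y ≡ X′ ++ x ∷ v ∷ y ∷ Y
    P≡ = ++-assoc X′ [ x ] (v ∷ y ∷ Y)
    x∷v∷y∷Y-unique : Unique (x ∷ v ∷ y ∷ Y)
    x∷v∷y∷Y-unique = proj₁ (proj₂ (Unique-++⁻ X′ (subst Unique P≡ uniq)))
    x≡y : x ≡ y
    x≡y = one-neighbour (subst (_∋ v — x) (sym P≡) (∋—-++⁺ʳ X′ first˘))
                        (subst (_∋ v — y) (sym P≡) (∋—-++⁺ʳ X′ (later first)))

  module _ {P : A → A → Set} (P-sym : ∀ {x y} → P x y → P y x) (P? : ∀ x y → Dec (P x y)) where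

    MixedVertex : List A → Set
    MixedVertex W = ∃₂ λ y x → ∃ λ z → W ∋ y — x × P y x × W ∋ y — z × ¬ P y z

    private
      later-mixed : {x y : A} {r : List A} → MixedVertex (y ∷ r) → MixedVertex (x ∷ y ∷ r)
      later-mixed (y , x , z , e , p , e′ , ¬p) = y , x , z , later e , p , later e′ , ¬p

      ∋—-tail-¬P : {x y c d : A} {r : List A} → P x y → x ∷ y ∷ r ∋ c — d → ¬ P c d → y ∷ r ∋ c — d
      ∋—-tail-¬P pxy first     ¬p = ⊥-elim (¬p pxy)
      ∋—-tail-¬P pxy first˘    ¬p = ⊥-elim (¬p (P-sym pxy))
      ∋—-tail-¬P pxy (later e) _  = e

      ∋—-tail-P : {x y a b : A} {r : List A} → ¬ P x y → x ∷ y ∷ r ∋ a — b → P a b → y ∷ r ∋ a — b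
      ∋—-tail-P ¬pxy first     p = ⊥-elim (¬pxy p)
      ∋—-tail-P ¬pxy first˘    p = ⊥-elim (¬pxy (P-sym p))
      ∋—-tail-P ¬pxy (later e) _ = e

      P-first⇒mixed : {x y c d : A} {r : List A} → P x y → y ∷ r ∋ c — d → ¬ P c d → MixedVertex (x ∷ y ∷ r)
      P-first⇒mixed pxy first ¬p = _ , _ , _ , first˘ , P-sym pxy , later first , ¬p
      P-first⇒mixed pxy first˘ ¬p = _ , _ , _ , first˘ , P-sym pxy , later first , ¬p ∘ P-sym
      P-first⇒mixed {x} {y} {r = s ∷ _} pxy (later e) ¬p with P? y s
      ... | yes pys = later-mixed (P-first⇒mixed pys e ¬p)
      ... | no ¬pys = y , x , s , first˘ , P-sym pxy , later first , ¬pys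

      ¬P-first⇒mixed : {x y a b : A} {r : List A} → ¬ P x y → y ∷ r ∋ a — b → P a b → MixedVertex (x ∷ y ∷ r)
      ¬P-first⇒mixed ¬pxy first p = _ , _ , _ , later first , p , first˘ , ¬pxy ∘ P-sym
      ¬P-first⇒mixed ¬pxy first˘ p = _ , _ , _ , later first , P-sym p , first˘ , ¬pxy ∘ P-sym
      ¬P-first⇒mixed {x} {y} {r = s ∷ _} ¬pxy (later e) p with P? y s
      ... | yes pys = y , s , x , later first , pys , first˘ , ¬pxy ∘ P-sym
      ... | no ¬pys = later-mixed (¬P-first⇒mixed ¬pys e p)

    mixedWalk⇒mixedVertex : {W : List A} {a b c d : A} →
                            W ∋ a — b → P a b → W ∋ c — d → ¬ P c d → MixedVertex W
    mixedWalk⇒mixedVertex {x ∷ y ∷ _} e₁ p e₂ ¬p with P? x y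
    ... | yes pxy = P-first⇒mixed pxy (∋—-tail-¬P pxy e₂ ¬p) ¬p
    ... | no ¬pxy = ¬P-first⇒mixed ¬pxy (∋—-tail-P ¬pxy e₁ p) p

  EdgeDisjoint : List A → List A → Set
  EdgeDisjoint P Q = ∀ {a b} → P ∋ a — b → ¬ Q ∋ a — b

  EdgeDisjoint-sym : {P Q : List A} → EdgeDisjoint P Q → EdgeDisjoint Q P
  EdgeDisjoint-sym P∩Q=∅ e e′ = P∩Q=∅ e′ e

  sharedEdge⇒≡ : {Ps : List (List A)} → AllPairs EdgeDisjoint Ps → {P Q : List A} {a b : A} →
                 P ∈ Ps → Q ∈ Ps → P ∋ a — b → Q ∋ a — b → P ≡ Q
  sharedEdge⇒≡ (_ ∷ _) (here refl) (here refl) _ _ = refl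
  sharedEdge⇒≡ (d ∷ _) (here refl) (there Q∈) e e′ = ⊥-elim (All.lookup d Q∈ e e′)
  sharedEdge⇒≡ (d ∷ _) (there P∈) (here refl) e e′ = ⊥-elim (All.lookup d P∈ e′ e)
  sharedEdge⇒≡ (_ ∷ ds) (there P∈) (there Q∈) e e′ = sharedEdge⇒≡ ds P∈ Q∈ e e′

  closedWalk : List A → List A
  closedWalk L = L ++ take 1 L

  ∈-closedWalk⁻ : (L : List A) {x : A} → x ∈ closedWalk L → x ∈ L
  ∈-closedWalk⁻ L x∈ with ∈-++⁻ L x∈
  ... | inj₁ x∈L = x∈L
  ∈-closedWalk⁻ (_ ∷ _) _ | inj₂ (here refl) = here refl

  record CycleThrough (L : List A) (w : A) : Set where
    field
      a b : A
      mid : List A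
      unique : Unique (w ∷ a ∷ mid ++ [ b ])
      sameEdges : SameEdges (closedWalk L) (w ∷ a ∷ mid ++ b ∷ [ w ])

    a≢b : a ≢ b
    a≢b a≡b = Unique.Unique[x∷xs]⇒x∉xs (AllPairs.tail unique) (∈-++⁺ʳ mid (here a≡b))

    w∉ : w ∉ a ∷ mid ++ [ b ]
    w∉ = Unique.Unique[x∷xs]⇒x∉xs unique

    b≢w : b ≢ w
    b≢w b≡w = w∉ (∈-++⁺ʳ (a ∷ mid) (here (sym b≡w)))

    w—a : closedWalk L ∋ w — a
    w—a = Equivalence.from sameEdges first

    w—b : closedWalk L ∋ w — b
    w—b = Equivalence.from sameEdges (∋—-++⁺ʳ (w ∷ a ∷ mid) first˘)

    path⇒closedWalk : {x y : A} → w ∷ a ∷ mid ++ [ b ] ∋ x — y → closedWalk L ∋ x — y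
    path⇒closedWalk = Equivalence.from sameEdges ∘ ∋—-++⁺ˡ (w ∷ a ∷ mid)

    closedWalk⇒path⊎last : {x y : A} → closedWalk L ∋ x — y →
                           w ∷ a ∷ mid ++ [ b ] ∋ x — y ⊎ b ∷ [ w ] ∋ x — y
    closedWalk⇒path⊎last = ∋—-++⁻ (w ∷ a ∷ mid) ∘ Equivalence.to sameEdges

    w-neighbours : {x : A} → closedWalk L ∋ w — x → x ≡ a ⊎ x ≡ b
    w-neighbours e with closedWalk⇒path⊎last e
    ... | inj₁ e′ = inj₁ (Unique-head-neighbour unique e′)
    ... | inj₂ e′ with ∋—-pair e′
    ...   | inj₁ (w≡b , _) = ⊥-elim (b≢w (sym w≡b))
    ...   | inj₂ (_ , x≡b) = inj₂ x≡b

  closedWalk-rotate : (X Y : List A) {w : A} → SameEdges (closedWalk (X ++ w ∷ Y)) (w ∷ (Y ++ X) ++ [ w ])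
  closedWalk-rotate [] Y {w} =
    subst (λ K → SameEdges (w ∷ Y ++ [ w ]) (w ∷ K ++ [ w ])) (sym (++-identityʳ Y)) (mk⇔ id id)
  closedWalk-rotate (y ∷ X) Y {w} =
    subst₂ SameEdges (sym (++-assoc (y ∷ X) (w ∷ Y) [ y ])) (cong (w ∷_) (sym (++-assoc Y (y ∷ X) [ w ])))
      (mk⇔ (∋—-rotate X Y) (∋—-rotate Y X))

  private
    cycleThrough-split : {L : List A} {w : A} (M : List A) → Unique (w ∷ M) → 2 ≤ length M →
                         SameEdges (closedWalk L) (w ∷ M ++ [ w ]) → CycleThrough L w
    cycleThrough-split (a ∷ M) u (s≤s _) same with initLast M
    cycleThrough-split (a ∷ _) u (s≤s ()) same | []
    cycleThrough-split {L} {w} (a ∷ _) u (s≤s _) same | mid ∷ʳ′ b = record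
      { a = a ; b = b ; mid = mid ; unique = u
      ; sameEdges = subst (λ K → SameEdges (closedWalk L) (w ∷ a ∷ K)) (++-assoc mid [ b ] [ w ]) same
      }

  cycleThrough : {L : List A} {w : A} → w ∈ L → Unique L → 3 ≤ length L → CycleThrough L w
  cycleThrough {w = w} w∈L u 3≤|L| with ∈-∃++ w∈L
  ... | X , Y , refl = cycleThrough-split (Y ++ X) (Unique-++-comm X u) 2≤|Y++X| (closedWalk-rotate X Y)
    where
    2≤|Y++X| : 2 ≤ length (Y ++ X)
    2≤|Y++X| with s≤s 2≤ ← subst (3 ≤_) (trans (length-++-sucʳ X w Y) (cong suc (length-++-comm X Y))) 3≤|L| = 2≤

reflects-map : {A B : Set} {b : Bool} → (A → B) → (B → A) → Reflects A b → Reflects B b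
reflects-map f g (ofʸ a) = ofʸ (f a)
reflects-map f g (ofⁿ ¬a) = ofⁿ (¬a ∘ g)

reflects-true : {A : Set} {b : Bool} → Reflects A b → b ≡ true → A
reflects-true r refl = invert r

reflects-false : {A : Set} {b : Bool} → Reflects A b → b ≡ false → ¬ A
reflects-false r refl = invert r

module _ {n : ℕ} where

  ==-reflects : (x y : Fin n) → Reflects (x ≡ y) (x == y)
  ==-reflects x y with x Fin.≟ y
  ... | yes x≡y = ofʸ x≡y
  ... | no x≢y = ofⁿ x≢y

  walkHas-reflects : (W : List (Fin n)) (a b : Fin n) → Reflects (W ∋ a — b) (walkHas W a b)
  walkHas-reflects [] a b = ofⁿ λ ()
  walkHas-reflects (x ∷ []) a b = ofⁿ λ ()
  walkHas-reflects (x ∷ y ∷ r) a b =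
    reflects-map fromCases toCases
      ((==-reflects x a ×-reflects ==-reflects y b) ⊎-reflects
       ((==-reflects x b ×-reflects ==-reflects y a) ⊎-reflects walkHas-reflects (y ∷ r) a b))
    where
    fromCases : (x ≡ a × y ≡ b) ⊎ (x ≡ b × y ≡ a) ⊎ y ∷ r ∋ a — b → x ∷ y ∷ r ∋ a — b
    fromCases (inj₁ (refl , refl)) = first
    fromCases (inj₂ (inj₁ (refl , refl))) = first˘
    fromCases (inj₂ (inj₂ e)) = later e
    toCases : x ∷ y ∷ r ∋ a — b → (x ≡ a × y ≡ b) ⊎ (x ≡ b × y ≡ a) ⊎ y ∷ r ∋ a — b
    toCases first = inj₁ (refl , refl)
    toCases first˘ = inj₂ (inj₁ (refl , refl))
    toCases (later e) = inj₂ (inj₂ e)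

  infix 4 _∋?_—_

  _∋?_—_ : (W : List (Fin n)) (a b : Fin n) → Dec (W ∋ a — b)
  W ∋? a — b = walkHas W a b because walkHas-reflects W a b

  walkHas⇒∋— : {W : List (Fin n)} {a b : Fin n} → walkHas W a b ≡ true → W ∋ a — b
  walkHas⇒∋— {W} {a} {b} = reflects-true (walkHas-reflects W a b)

  walkHas≡false⇒∌— : {W : List (Fin n)} {a b : Fin n} → walkHas W a b ≡ false → ¬ W ∋ a — b
  walkHas≡false⇒∌— {W} {a} {b} = reflects-false (walkHas-reflects W a b)

  ∋—⇒walkHas : {W : List (Fin n)} {a b : Fin n} → W ∋ a — b → walkHas W a b ≡ true
  ∋—⇒walkHas {W} {a} {b} = dec-true (W ∋? a — b)

  ∌—⇒walkHas≡false : {W : List (Fin n)} {a b : Fin n} → ¬ W ∋ a — b → walkHas W a b ≡ false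
  ∌—⇒walkHas≡false {W} {a} {b} = dec-false (W ∋? a — b)

  module _ (H : Graph n) where

    WalkIn⇒adj : {W : List (Fin n)} → WalkIn H W → ∀ {a b} → W ∋ a — b → adj H a b ≡ true
    WalkIn⇒adj (h , _) first = h
    WalkIn⇒adj (h , _) first˘ = trans (adj-sym H _ _) h
    WalkIn⇒adj (_ , w) (later e) = WalkIn⇒adj w e

    adj⇒WalkIn : (W : List (Fin n)) → (∀ {a b} → W ∋ a — b → adj H a b ≡ true) → WalkIn H W
    adj⇒WalkIn [] _ = tt
    adj⇒WalkIn (x ∷ []) _ = tt
    adj⇒WalkIn (x ∷ y ∷ r) edges = edges first , adj⇒WalkIn (y ∷ r) (edges ∘ later)

    IsPath-join : (L : List (Fin n)) {v : Fin n} {R : List (Fin n)} →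
                  IsPath H (L ++ [ v ]) → IsPath H (v ∷ R) → Disjoint L R → IsPath H (L ++ v ∷ R)
    IsPath-join L {v} {R} (uLv , wLv) (uvR , wvR) L∩R=∅ with Unique-++⁻ L uLv
    ... | uL , _ , L∩v=∅ = Unique.++⁺ uL uvR L∩vR=∅ , adj⇒WalkIn (L ++ v ∷ R) edges
      where
      L∩vR=∅ : Disjoint L (v ∷ R)
      L∩vR=∅ (z∈L , here refl) = L∩v=∅ (z∈L , here refl)
      L∩vR=∅ (z∈L , there z∈R) = L∩R=∅ (z∈L , z∈R)
      edges : ∀ {a b} → L ++ v ∷ R ∋ a — b → adj H a b ≡ true
      edges e = [ WalkIn⇒adj wLv , WalkIn⇒adj wvR ]′ (∋—-++⁻ L e)

    IsPath-reverse : {W : List (Fin n)} → IsPath H W → IsPath H (reverse W)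
    IsPath-reverse {W} (u , w) = Unique-reverse u , adj⇒WalkIn (reverse W) (WalkIn⇒adj w ∘ ∋—-reverse⁻)

sum-indicator≡length-filter : {A : Set} (p : A → Bool) (xs : List A) →
                              sum (map (λ x → if p x then 1 else 0) xs) ≡ length (filter (T? ∘ p) xs)
sum-indicator≡length-filter p [] = refl
sum-indicator≡length-filter p (x ∷ xs) with p x
... | true = cong suc (sum-indicator≡length-filter p xs)
... | false = sum-indicator≡length-filter p xs

module _ {n : ℕ} (G : Graph n) where

  neighbours : Fin n → List (Fin n)
  neighbours w = filter (T? ∘ adj G w) (allFin n)

  deg≡length-neighbours : (w : Fin n) → deg G w ≡ length (neighbours w)
  deg≡length-neighbours w = sum-indicator≡length-filter (adj G w) (allFin n)

  length≤deg : {w : Fin n} {us : List (Fin n)} → Unique us → (∀ {u} → u ∈ us → adj G w u ≡ true) →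
               length us ≤ deg G w
  length≤deg {w} {us} u-us adjacent =
    subst (length us ≤_) (sym (deg≡length-neighbours w))
      (Unique⇒length≤ u-us λ u∈us → ∈-filter⁺ (T? ∘ adj G w) (∈-allFin _) (Equivalence.from T-≡ (adjacent u∈us)))

  deg≤length : {w : Fin n} {us : List (Fin n)} → (∀ {u} → adj G w u ≡ true → u ∈ us) → deg G w ≤ length us
  deg≤length {w} {us} covered =
    subst (_≤ length us) (sym (deg≡length-neighbours w))
      (Unique⇒length≤ (Unique.filter⁺ (T? ∘ adj G w) (Unique.allFin⁺ n))
        (λ u∈N → covered (Equivalence.to T-≡ (proj₂ (∈-filter⁻ (T? ∘ adj G w) {xs = allFin n} u∈N)))))

record IsPathPartition {n : ℕ} (H : Graph n) (Ps : List (List (Fin n))) : Set where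
  field
    allPaths : All (IsPath H) Ps
    pairwiseDisjoint : AllPairs EdgeDisjoint Ps
    covering : ∀ {a b} → adj H a b ≡ true → Any (_∋ a — b) Ps

module _ {n : ℕ} {H : Graph n} where

  fromPathPartition : (P : PathPartition H) → IsPathPartition H (paths P)
  fromPathPartition P = record
    { allPaths = arePaths P
    ; pairwiseDisjoint = AllPairs-fromLookup (paths P) λ i j i≢j e →
        walkHas≡false⇒∌— (disjoint P i j i≢j _ _ (∋—⇒walkHas e))
    ; covering = λ a—b → let (i , e) = covers P _ _ a—b in lose (∈-lookup i) (walkHas⇒∋— e)
    }

  toPathPartition : {Ps : List (List (Fin n))} → IsPathPartition H Ps → PathPartition H
  toPathPartition {Ps} record { allPaths = ps ; pairwiseDisjoint = ds ; covering = cs } = record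
    { paths = Ps
    ; arePaths = ps
    ; disjoint = λ i j i≢j _ _ e →
        ∌—⇒walkHas≡false (AllPairs-lookup EdgeDisjoint-sym ds i j i≢j (walkHas⇒∋— e))
    ; covers = λ _ _ a—b → Any.index (cs a—b) , ∋—⇒walkHas (lookup-index (cs a—b))
    }

module _ {n : ℕ} (H : Graph n) where

  run runTail : Fin n → List (Fin n) → List (Fin n)
  run y r = y ∷ runTail y r
  runTail y [] = []
  runTail y (z ∷ r) = if adj H y z then run z r else []

  firstRun : List (Fin n) → List (Fin n)
  firstRun [] = []
  firstRun (x ∷ []) = []
  firstRun (x ∷ y ∷ r) = if adj H x y then x ∷ run y r else firstRun (y ∷ r)

  run-⊆ : (y : Fin n) (r : List (Fin n)) → run y r ⊆ y ∷ r
  run-⊆ y r (here refl) = here refl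
  run-⊆ y (z ∷ r) (there x∈) with adj H y z
  ... | true = there (run-⊆ z r x∈)

  run-unique : (y : Fin n) (r : List (Fin n)) → Unique (y ∷ r) → Unique (run y r)
  run-unique y [] u = u
  run-unique y (z ∷ r) (y∉ ∷ u) with adj H y z
  ... | true = All.tabulate (All.lookup y∉ ∘ run-⊆ z r) ∷ run-unique z r u
  ... | false = [] ∷ []

  run-walk : (y : Fin n) (r : List (Fin n)) → WalkIn H (run y r)
  run-walk y [] = tt
  run-walk y (z ∷ r) with adj H y z in y—z
  ... | true = y—z , run-walk z r
  ... | false = tt

  run-∋— : (y : Fin n) (r : List (Fin n)) {a b : Fin n} → run y r ∋ a — b → y ∷ r ∋ a — b
  run-∋— y (z ∷ r) e with adj H y z
  run-∋— y (z ∷ r) first | true = first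
  run-∋— y (z ∷ r) first˘ | true = first˘
  run-∋— y (z ∷ r) (later e) | true = later (run-∋— z r e)

  firstRun-isPath : (W : List (Fin n)) → Unique W → IsPath H (firstRun W)
  firstRun-isPath [] _ = [] , tt
  firstRun-isPath (x ∷ []) _ = [] , tt
  firstRun-isPath (x ∷ y ∷ r) (x∉ ∷ u) with adj H x y in x—y
  ... | true = All.tabulate (All.lookup x∉ ∘ run-⊆ y r) ∷ run-unique y r u , x—y , run-walk y r
  ... | false = firstRun-isPath (y ∷ r) u

  firstRun-skip : {x y : Fin n} {r : List (Fin n)} → adj H x y ≡ false → firstRun (x ∷ y ∷ r) ≡ firstRun (y ∷ r)
  firstRun-skip x—y rewrite x—y = refl

  -- The induction hypothesis for the tail is passed in as an argument: inside a with-clause the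
  -- termination checker no longer sees that y ∷ r is smaller than x ∷ y ∷ r.
  firstRun-∋— : (W : List (Fin n)) {a b : Fin n} → firstRun W ∋ a — b → W ∋ a — b
  firstRun-∋— (x ∷ y ∷ r) = inFirstEdgeOrTail (firstRun-∋— (y ∷ r))
    where
    inFirstEdgeOrTail : (∀ {a b} → firstRun (y ∷ r) ∋ a — b → y ∷ r ∋ a — b) →
                        ∀ {a b} → firstRun (x ∷ y ∷ r) ∋ a — b → x ∷ y ∷ r ∋ a — b
    inFirstEdgeOrTail tail e with adj H x y
    inFirstEdgeOrTail tail first | true = first
    inFirstEdgeOrTail tail first˘ | true = first˘
    inFirstEdgeOrTail tail (later e) | true = later (run-∋— y r e)
    ... | false = later (tail e)

  firstRun-edgeless : (W : List (Fin n)) → (∀ {a b} → W ∋ a — b → adj H a b ≡ false) → firstRun W ≡ []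
  firstRun-edgeless [] _ = refl
  firstRun-edgeless (x ∷ []) _ = refl
  firstRun-edgeless (x ∷ y ∷ r) non-H =
    trans (firstRun-skip {r = r} (non-H first)) (firstRun-edgeless (y ∷ r) (non-H ∘ later))

module Pan {n : ℕ} (G : Graph n) (C : Cycle G) (v : Fin n) (v∈C : v ∈ verts C) (deg-v : deg G v ≡ 3)
           (deg-rest : ∀ w → w ∈ verts C → ¬ (w ≡ v) → deg G w ≡ 2) where

  GC : Graph n
  GC = G −C C

  CycleEdge : Fin n → Fin n → Set
  CycleEdge a b = closedWalk (verts C) ∋ a — b

  CycleEdge? : ∀ a b → Dec (CycleEdge a b)
  CycleEdge? a b = closedWalk (verts C) ∋? a — b

  CycleEdge⇒adj : {a b : Fin n} → CycleEdge a b → adj G a b ≡ true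
  CycleEdge⇒adj = WalkIn⇒adj G (closed C)

  CycleEdge⇒∈ : {a b : Fin n} → CycleEdge a b → a ∈ verts C
  CycleEdge⇒∈ = ∈-closedWalk⁻ (verts C) ∘ ∋—⇒∈

  GC⇒G : {a b : Fin n} → adj GC a b ≡ true → adj G a b ≡ true
  GC⇒G = ∧-conicalˡ _ _

  GC⇒¬CycleEdge : {a b : Fin n} → adj GC a b ≡ true → ¬ CycleEdge a b
  GC⇒¬CycleEdge a—b = walkHas≡false⇒∌— (not-injective (∧-conicalʳ _ _ a—b))

  offCycle⇒GC : {a b : Fin n} → adj G a b ≡ true → ¬ CycleEdge a b → adj GC a b ≡ true
  offCycle⇒GC a—b ¬c = cong₂ _∧_ a—b (cong not (∌—⇒walkHas≡false ¬c))

  ¬GC⇒CycleEdge : {a b : Fin n} → adj G a b ≡ true → adj GC a b ≡ false → CycleEdge a b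
  ¬GC⇒CycleEdge {a} {b} a—b ¬gc with CycleEdge? a b
  ... | yes c = c
  ... | no ¬c = contradiction (trans (sym (offCycle⇒GC a—b ¬c)) ¬gc) λ ()

  GC-path⇒G-path : {P : List (Fin n)} → IsPath GC P → IsPath G P
  GC-path⇒G-path {P} (u , w) = u , adj⇒WalkIn G P (GC⇒G ∘ WalkIn⇒adj GC w)

  cycleAt : {w : Fin n} → w ∈ verts C → CycleThrough (verts C) w
  cycleAt w∈C = cycleThrough w∈C (distinct C) (len≥3 C)

  private module AtV = CycleThrough (cycleAt v∈C)

  onlyCycleEdges : {w x : Fin n} → w ∈ verts C → w ≢ v → adj G w x ≡ true → CycleEdge w x
  onlyCycleEdges {w} {x} w∈C w≢v w—x with CycleEdge? w x
  ... | yes c = c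
  ... | no ¬c = contradiction (subst (3 ≤_) (deg-rest w w∈C w≢v) (length≤deg G abx-unique adjacent)) (n≮n 2)
    where
    open CycleThrough (cycleAt w∈C)
    ≢x : ∀ {y} → CycleEdge w y → y ≢ x
    ≢x c refl = ¬c c
    abx-unique : Unique (a ∷ b ∷ x ∷ [])
    abx-unique = (a≢b ∷ ≢x w—a ∷ []) ∷ (≢x w—b ∷ []) ∷ [] ∷ []
    adjacent : ∀ {y} → y ∈ a ∷ b ∷ x ∷ [] → adj G w y ≡ true
    adjacent (here refl) = CycleEdge⇒adj w—a
    adjacent (there (here refl)) = CycleEdge⇒adj w—b
    adjacent (there (there (here refl))) = w—x

  GCEdge-onCycle⇒≡v : {w x : Fin n} → w ∈ verts C → adj GC w x ≡ true → w ≡ v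
  GCEdge-onCycle⇒≡v {w} w∈C w—x with w Fin.≟ v
  ... | yes w≡v = w≡v
  ... | no w≢v = ⊥-elim (GC⇒¬CycleEdge w—x (onlyCycleEdges w∈C w≢v (GC⇒G w—x)))

  handle : ∃ λ u → adj G v u ≡ true × ¬ CycleEdge v u
  handle with Finₚ.any? (λ u → (adj G v u Bool.≟ true) ×-dec ¬? (CycleEdge? v u))
  ... | yes h = h
  ... | no ∄ = contradiction (subst (_≤ 2) deg-v (deg≤length G onCycle)) (n≮n 2)
    where
    onCycle : ∀ {y} → adj G v y ≡ true → y ∈ AtV.a ∷ AtV.b ∷ []
    onCycle {y} v—y with CycleEdge? v y
    ... | no ¬c = ⊥-elim (∄ (y , v—y , ¬c))
    ... | yes c with AtV.w-neighbours c
    ...   | inj₁ refl = here refl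
    ...   | inj₂ refl = there (here refl)

  u : Fin n
  u = proj₁ handle

  v—u : adj G v u ≡ true
  v—u = proj₁ (proj₂ handle)

  v—u-offCycle : ¬ CycleEdge v u
  v—u-offCycle = proj₂ (proj₂ handle)

  handle-unique : {x : Fin n} → adj G v x ≡ true → ¬ CycleEdge v x → x ≡ u
  handle-unique {x} v—x ¬c with x Fin.≟ u
  ... | yes x≡u = x≡u
  ... | no x≢u = contradiction (subst (4 ≤_) deg-v (length≤deg G abxu-unique adjacent)) (n≮n 3)
    where
    open AtV
    ≢offCycle : ∀ {y z} → CycleEdge v y → ¬ CycleEdge v z → y ≢ z
    ≢offCycle c ¬c refl = ¬c c
    abxu-unique : Unique (a ∷ b ∷ x ∷ u ∷ [])
    abxu-unique = (a≢b ∷ ≢offCycle w—a ¬c ∷ ≢offCycle w—a v—u-offCycle ∷ [])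
                ∷ (≢offCycle w—b ¬c ∷ ≢offCycle w—b v—u-offCycle ∷ []) ∷ (x≢u ∷ []) ∷ [] ∷ []
    adjacent : ∀ {y} → y ∈ a ∷ b ∷ x ∷ u ∷ [] → adj G v y ≡ true
    adjacent (here refl) = CycleEdge⇒adj w—a
    adjacent (there (here refl)) = CycleEdge⇒adj w—b
    adjacent (there (there (here refl))) = v—x
    adjacent (there (there (there (here refl)))) = v—u

  GC-handle-unique : {x : Fin n} → adj GC v x ≡ true → x ≡ u
  GC-handle-unique v—x = handle-unique (GC⇒G v—x) (GC⇒¬CycleEdge v—x)

  mixedWalk⇒handle : {W : List (Fin n)} {a b c d : Fin n} → WalkIn G W →
                     W ∋ a — b → CycleEdge a b → W ∋ c — d → ¬ CycleEdge c d → W ∋ v — u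
  mixedWalk⇒handle walk e₁ c e₂ ¬c with mixedWalk⇒mixedVertex ∋—-sym CycleEdge? e₁ c e₂ ¬c
  ... | _ , _ , _ , _ , c-yx , y—z , ¬c-yz
    with y—z-GC ← offCycle⇒GC (WalkIn⇒adj G walk y—z) ¬c-yz
    with refl ← GCEdge-onCycle⇒≡v (CycleEdge⇒∈ c-yx) y—z-GC
    with refl ← GC-handle-unique y—z-GC
    = y—z

  leftGC⇒noGCEdge : {x y z a b : Fin n} {r : List (Fin n)} → Unique (y ∷ z ∷ r) → WalkIn G (y ∷ z ∷ r) →
                    adj GC y x ≡ true → CycleEdge y z → y ∷ z ∷ r ∋ a — b → ¬ adj GC a b ≡ true
  leftGC⇒noGCEdge uniq walk y—x c-yz e a—b
    with refl ← GCEdge-onCycle⇒≡v (CycleEdge⇒∈ c-yz) y—x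
    with refl ← Unique-head-neighbour uniq (mixedWalk⇒handle walk first c-yz e (GC⇒¬CycleEdge a—b))
    = v—u-offCycle c-yz

  run-complete : (y : Fin n) (r : List (Fin n)) → Unique (y ∷ r) → WalkIn G (y ∷ r) →
                 (∃ λ x → adj GC y x ≡ true) →
                 ∀ {a b} → y ∷ r ∋ a — b → adj GC a b ≡ true → run GC y r ∋ a — b
  run-complete y (z ∷ r) uniq walk (x , y—x) e a—b with adj GC y z in y—z
  run-complete y (z ∷ r) _ _ _ first _ | true = first
  run-complete y (z ∷ r) _ _ _ first˘ _ | true = first˘
  run-complete y (z ∷ r) (_ ∷ uniq) (_ , walk) _ (later e) a—b | true =
    later (run-complete z r uniq walk (y , trans (adj-sym GC z y) y—z) e a—b)
  ... | false = ⊥-elim (leftGC⇒noGCEdge uniq walk y—x (¬GC⇒CycleEdge (proj₁ walk) y—z) e a—b)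

  firstRun-complete : (W : List (Fin n)) → Unique W → WalkIn G W →
                      ∀ {a b} → W ∋ a — b → adj GC a b ≡ true → firstRun GC W ∋ a — b
  firstRun-complete (x ∷ y ∷ r) (_ ∷ uniq) (_ , walk) = inFirstEdgeOrTail (firstRun-complete (y ∷ r) uniq walk)
    where
    inFirstEdgeOrTail : (∀ {a b} → y ∷ r ∋ a — b → adj GC a b ≡ true → firstRun GC (y ∷ r) ∋ a — b) →
                        ∀ {a b} → x ∷ y ∷ r ∋ a — b → adj GC a b ≡ true → firstRun GC (x ∷ y ∷ r) ∋ a — b
    inFirstEdgeOrTail tail e a—b with adj GC x y in x—y
    inFirstEdgeOrTail tail first a—b | true = first
    inFirstEdgeOrTail tail first˘ a—b | true = first˘
    inFirstEdgeOrTail tail (later e) a—b | true = later (run-complete y r uniq walk (x , trans (adj-sym GC y x) x—y) e a—b)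
    inFirstEdgeOrTail tail first a—b | false = contradiction (trans (sym a—b) x—y) λ ()
    inFirstEdgeOrTail tail first˘ a—b | false = contradiction (trans (sym a—b) (trans (adj-sym GC y x) x—y)) λ ()
    inFirstEdgeOrTail tail (later e) a—b | false = tail e a—b

  handlePath-missesCycleEdge : {P : List (Fin n)} → Unique P → P ∋ v — u → ∃ λ c → CycleEdge v c × ¬ P ∋ v — c
  handlePath-missesCycleEdge {P} uniq v—u∈P with P ∋? v — AtV.a | P ∋? v — AtV.b
  ... | no v—a∉P | _ = AtV.a , AtV.w—a , v—a∉P
  ... | yes _ | no v—b∉P = AtV.b , AtV.w—b , v—b∉P
  ... | yes v—a∈P | yes v—b∈P =
    ⊥-elim (path-noThreeNeighbours uniq v—u∈P v—a∈P v—b∈P (≢u AtV.w—a ∘ sym) (≢u AtV.w—b ∘ sym) AtV.a≢b)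
    where
    ≢u : ∀ {y} → CycleEdge v y → y ≢ u
    ≢u c refl = v—u-offCycle c

  module _ {Qs : List (List (Fin n))} (iq : IsPathPartition G Qs) where
    open IsPathPartition iq

    pureCyclePath : ∃ λ Pc → Pc ∈ Qs × (∀ {a b} → Pc ∋ a — b → adj GC a b ≡ false)
    pureCyclePath with find (covering v—u)
    ... | P₀ , P₀∈ , v—u∈P₀ with handlePath-missesCycleEdge (proj₁ (All.lookup allPaths P₀∈)) v—u∈P₀
    ... | c , v—c , v—c∉P₀ with find (covering (CycleEdge⇒adj v—c))
    ... | Pc , Pc∈ , v—c∈Pc = Pc , Pc∈ , pure
      where
      pure : ∀ {x y} → Pc ∋ x — y → adj GC x y ≡ false
      pure {x} {y} e with adj GC x y in x—y
      ... | false = refl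
      ... | true = ⊥-elim (v—c∉P₀ (subst (_∋ v — c) Pc≡P₀ v—c∈Pc))
        where
        Pc≡P₀ : Pc ≡ P₀
        Pc≡P₀ = sharedEdge⇒≡ pairwiseDisjoint Pc∈ P₀∈
                  (mixedWalk⇒handle (proj₂ (All.lookup allPaths Pc∈)) v—c∈Pc v—c e (GC⇒¬CycleEdge x—y))
                  v—u∈P₀

    restrictToGC : ∃ λ Ps → IsPathPartition GC Ps × suc (length Ps) ≤ length Qs
    restrictToGC with pureCyclePath
    ... | Pc , Pc∈ , Pc-pure = filter hasEdge? runs , record
      { allPaths = Allₚ.filter⁺ hasEdge? (Allₚ.map⁺ (All.map (firstRun-isPath GC _ ∘ proj₁) allPaths))
      ; pairwiseDisjoint = AllPairsₚ.filter⁺ hasEdge? (AllPairsₚ.map⁺ (AllPairs.map runs-disjoint pairwiseDisjoint))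
      ; covering = covering′
      } , subst (suc (length (filter hasEdge? runs)) ≤_) (length-map (firstRun GC) Qs)
            (filter-notAll hasEdge? runs (lose (∈-map⁺ (firstRun GC) Pc∈) Pc-run-edgeless))
      where
      hasEdge? : (P : List (Fin n)) → Dec (2 ≤ length P)
      hasEdge? P = 2 ≤? length P

      runs : List (List (Fin n))
      runs = map (firstRun GC) Qs

      runs-disjoint : ∀ {P Q} → EdgeDisjoint P Q → EdgeDisjoint (firstRun GC P) (firstRun GC Q)
      runs-disjoint {P} {Q} P∩Q=∅ e e′ = P∩Q=∅ (firstRun-∋— GC P e) (firstRun-∋— GC Q e′)

      covering′ : ∀ {a b} → adj GC a b ≡ true → Any (_∋ a — b) (filter hasEdge? runs)
      covering′ a—b with find (covering (GC⇒G a—b))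
      ... | P , P∈ , e with All.lookup allPaths P∈
      ... | uniq , walk with firstRun-complete P uniq walk e a—b
      ... | e′ = lose (∈-filter⁺ hasEdge? (∈-map⁺ (firstRun GC) P∈) (∋—⇒2≤length e′)) e′

      Pc-run-edgeless : ¬ 2 ≤ length (firstRun GC Pc)
      Pc-run-edgeless rewrite firstRun-edgeless GC Pc Pc-pure = λ ()

  handlePath-orient : {P₀ : List (Fin n)} → IsPath GC P₀ → P₀ ∋ v — u →
                      ∃ λ X → IsPath GC (X ++ [ v ]) × SameEdges P₀ (X ++ [ v ])
  handlePath-orient {P₀} path@(uniq , walk) v—u∈P₀ with path-endpoint uniq (∋—⇒∈ v—u∈P₀) one-neighbour
    where
    one-neighbour : ∀ {x y} → P₀ ∋ v — x → P₀ ∋ v — y → x ≡ y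
    one-neighbour e e′ = trans (GC-handle-unique (WalkIn⇒adj GC walk e)) (sym (GC-handle-unique (WalkIn⇒adj GC walk e′)))
  ... | inj₁ (X , refl) = X , path , mk⇔ id id
  ... | inj₂ (Y , refl) = reverse Y , subst (IsPath GC) reversed (IsPath-reverse GC path) ,
                          mk⇔ (subst (_∋ _ — _) reversed ∘ ∋—-reverse⁺)
                              (∋—-reverse⁻ ∘ subst (_∋ _ — _) (sym reversed))
    where
    reversed : reverse (v ∷ Y) ≡ reverse Y ++ [ v ]
    reversed = unfold-reverse v Y

  record Rerouting (P₀ : List (Fin n)) : Set where
    field
      N E : List (Fin n)
      N-path : IsPath G N
      E-path : IsPath G E
      N∩E=∅ : EdgeDisjoint N E
      sound : ∀ {a b} → N ∋ a — b ⊎ E ∋ a — b → P₀ ∋ a — b ⊎ CycleEdge a b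
      complete : ∀ {a b} → P₀ ∋ a — b ⊎ CycleEdge a b → N ∋ a — b ⊎ E ∋ a — b

  rerouting : {P₀ : List (Fin n)} → IsPath GC P₀ → P₀ ∋ v — u → Rerouting P₀
  rerouting P₀-path v—u∈P₀ with handlePath-orient P₀-path v—u∈P₀
  ... | X , Xv-path@(Xv-unique , Xv-walk) , P₀≈Xv = record
    { N = X ++ v ∷ cycleTail
    ; E = AtV.b ∷ [ v ]
    ; N-path = IsPath-join G X (GC-path⇒G-path Xv-path) cyclePath X∩cycleTail=∅
    ; E-path = ((AtV.b≢w ∷ []) ∷ [] ∷ []) , CycleEdge⇒adj (∋—-sym AtV.w—b) , tt
    ; N∩E=∅ = N∩E=∅
    ; sound = [ [ inj₁ ∘ Equivalence.from P₀≈Xv , inj₂ ∘ AtV.path⇒closedWalk ]′ ∘ ∋—-++⁻ X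
              , inj₂ ∘ E⇒CycleEdge ]′
    ; complete = [ inj₁ ∘ ∋—-++⁺ˡ X ∘ Equivalence.to P₀≈Xv
                 , map₁ (∋—-++⁺ʳ X) ∘ AtV.closedWalk⇒path⊎last ]′
    }
    where
    cycleTail : List (Fin n)
    cycleTail = AtV.a ∷ AtV.mid ++ [ AtV.b ]

    cyclePath : IsPath G (v ∷ cycleTail)
    cyclePath = AtV.unique , adj⇒WalkIn G (v ∷ cycleTail) (CycleEdge⇒adj ∘ AtV.path⇒closedWalk)

    X∩cycleTail=∅ : Disjoint X cycleTail
    X∩cycleTail=∅ (x∈X , x∈tail)
      with ∈⇒∋— first (there x∈tail) | ∈⇒∋— (Equivalence.to P₀≈Xv v—u∈P₀) (∈-++⁺ˡ x∈X)
    ... | _ , x—y | _ , x—y′ = proj₂ (proj₂ (Unique-++⁻ X Xv-unique)) (x∈X , here x≡v)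
      where
      x≡v = GCEdge-onCycle⇒≡v (CycleEdge⇒∈ (AtV.path⇒closedWalk x—y)) (WalkIn⇒adj GC Xv-walk x—y′)

    E⇒CycleEdge : ∀ {x y} → AtV.b ∷ [ v ] ∋ x — y → CycleEdge x y
    E⇒CycleEdge e with ∋—-pair e
    ... | inj₁ (refl , refl) = ∋—-sym AtV.w—b
    ... | inj₂ (refl , refl) = AtV.w—b

    N∩E=∅ : EdgeDisjoint (X ++ v ∷ cycleTail) (AtV.b ∷ [ v ])
    N∩E=∅ e e′ with ∋—-++⁻ X e | ∋—-pair e′
    ... | inj₁ e-X | _ = GC⇒¬CycleEdge (WalkIn⇒adj GC Xv-walk e-X) (E⇒CycleEdge e′)
    ... | inj₂ e-C | inj₁ (refl , refl) = AtV.a≢b (sym (Unique-head-neighbour AtV.unique (∋—-sym e-C)))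
    ... | inj₂ e-C | inj₂ (refl , refl) = AtV.a≢b (sym (Unique-head-neighbour AtV.unique e-C))

  module _ {Ps : List (List (Fin n))} (ip : IsPathPartition GC Ps) where
    open IsPathPartition ip

    reroute : {P₀ : List (Fin n)} → P₀ ∈ Ps → P₀ ∋ v — u → Rerouting P₀ →
              ∃ λ Rs → IsPathPartition G Rs × length Rs ≤ suc (length Ps)
    reroute {P₀} P₀∈ v—u∈P₀ R = N ∷ E ∷ rest , record
      { allPaths = N-path ∷ E-path ∷ Allₚ.filter⁺ avoidsHandle? (All.map GC-path⇒G-path allPaths)
      ; pairwiseDisjoint = (N∩E=∅ ∷ All.tabulate (λ Q∈ e → avoidsRest Q∈ (inj₁ e)))
                         ∷ All.tabulate (λ Q∈ e → avoidsRest Q∈ (inj₂ e))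
                         ∷ AllPairsₚ.filter⁺ avoidsHandle? pairwiseDisjoint
      ; covering = covering′
      } , s≤s (filter-notAll avoidsHandle? Ps (lose P₀∈ λ v—u∉P₀ → v—u∉P₀ v—u∈P₀))
      where
      open Rerouting R

      avoidsHandle? : (Q : List (Fin n)) → Dec (¬ Q ∋ v — u)
      avoidsHandle? Q = ¬? (Q ∋? v — u)

      rest : List (List (Fin n))
      rest = filter avoidsHandle? Ps

      N∪E : ∀ {a b} → N ∋ a — b ⊎ E ∋ a — b → Any (_∋ a — b) (N ∷ E ∷ rest)
      N∪E = [ here , there ∘ here ]′

      ≡P₀ : ∀ {Q a b} → Q ∈ Ps → Q ∋ a — b → P₀ ∋ a — b → Q ≡ P₀
      ≡P₀ Q∈Ps = sharedEdge⇒≡ pairwiseDisjoint Q∈Ps P₀∈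

      avoidsRest : ∀ {Q} → Q ∈ rest → ∀ {a b} → N ∋ a — b ⊎ E ∋ a — b → ¬ Q ∋ a — b
      avoidsRest Q∈ e e-Q with ∈-filter⁻ avoidsHandle? Q∈ | sound e
      ... | Q∈Ps , v—u∉Q | inj₁ e-P₀ = v—u∉Q (subst (_∋ v — u) (sym (≡P₀ Q∈Ps e-Q e-P₀)) v—u∈P₀)
      ... | Q∈Ps , _ | inj₂ c = GC⇒¬CycleEdge (WalkIn⇒adj GC (proj₂ (All.lookup allPaths Q∈Ps)) e-Q) c

      covering′ : ∀ {a b} → adj G a b ≡ true → Any (_∋ a — b) (N ∷ E ∷ rest)
      covering′ {a} {b} a—b with CycleEdge? a b
      ... | yes c = N∪E (complete (inj₂ c))
      ... | no ¬c with find (covering (offCycle⇒GC a—b ¬c))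
      ...   | Q , Q∈Ps , e-Q with Q ∋? v — u
      ...     | yes v—u∈Q = N∪E (complete (inj₁ (subst (_∋ a — b) (≡P₀ Q∈Ps v—u∈Q v—u∈P₀) e-Q)))
      ...     | no v—u∉Q = there (there (lose (∈-filter⁺ avoidsHandle? Q∈Ps v—u∉Q) e-Q))

    extendToG : ∃ λ Rs → IsPathPartition G Rs × length Rs ≤ suc (length Ps)
    extendToG with find (covering (offCycle⇒GC v—u v—u-offCycle))
    ... | P₀ , P₀∈ , v—u∈P₀ = reroute P₀∈ v—u∈P₀ (rerouting (All.lookup allPaths P₀∈) v—u∈P₀)

  extendPartition : (P : PathPartition GC) → Σ (PathPartition G) λ R → size R ≤ suc (size P)
  extendPartition P = toPathPartition (proj₁ (proj₂ extended)) , proj₂ (proj₂ extended)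
    where extended = extendToG (fromPathPartition P)

  restrictPartition : (Q : PathPartition G) → Σ (PathPartition GC) λ P → suc (size P) ≤ size Q
  restrictPartition Q = toPathPartition (proj₁ (proj₂ restricted)) , proj₂ (proj₂ restricted)
    where restricted = restrictToGC (fromPathPartition Q)

lemma5 : {n : ℕ} (G : Graph n) (C : Cycle G) → IsPanCycle G C →
    ∀ (k : ℕ) → IsPn (G −C C) k → IsPn G (suc k)
lemma5 G C (v , v∈C , deg-v , deg-rest) k ((P , |P|≡k) , k≤) = (R , ≤-antisym |R|≤1+k (pn≥1+k R)) , pn≥1+k
  where
  open Pan G C v v∈C deg-v deg-rest
  R = proj₁ (extendPartition P)
  |R|≤1+k : size R ≤ suc k
  |R|≤1+k = subst (λ m → size R ≤ suc m) |P|≡k (proj₂ (extendPartition P))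
  pn≥1+k : ∀ Q → suc k ≤ size Q
  pn≥1+k Q = ≤-trans (s≤s (k≤ (proj₁ (restrictPartition Q)))) (proj₂ (restrictPartition Q))
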